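{- Let $f:\mathbf{N}\to\mathbf{N}\cup\{\infty\}$ be any function, and let $\mathbf{P}_f$ be the set of integer partitions in which, for every $i$, the part $i$ appears at most $f(i)$ times. Then $\mathbf{P}_f$ is a distributive sublattice of the Young lattice, i.e. it is closed under the partwise join $(\lambda\vee\mu)_i=\max(\lambda_i,\mu_i)$ and partwise meet $(\lambda\wedge\mu)_i=\min(\lambda_i,\mu_i)$, and is a distributive lattice with these operations.
   Context: The Young lattice is the set of all integer partitions ordered by $\lambda\le\mu$ iff $\lambda$ has at most as many parts as $\mu$ and $\lambda_i\le\mu_i$ for all $i$; partitions are padded with zero parts when comparing or taking partwise max/min. $\mathbf{N}$ denotes the positive integers. -}

module Defs where

open import Data.Nat using (ℕ; zero; suc; _≤_; _≥_; _⊔_; _⊓_; _≟_)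
open import Data.List using (List; []; _∷_; length; filter)
open import Data.List.Relation.Unary.All using (All)
open import Data.List.Relation.Unary.Linked using (Linked)
open import Data.Maybe using (Maybe; just; nothing)
open import Data.Unit using (⊤)
open import Data.Product using (Σ; _×_; _,_; proj₁)
open import Relation.Binary.PropositionalEquality using (_≡_)

-- ℕ ∪ {∞}: nothing = ∞, just k = k
ℕ∞ : Set
ℕ∞ = Maybe ℕ

_≤∞_ : ℕ → ℕ∞ → Set
n ≤∞ nothing = ⊤
n ≤∞ just k  = n ≤ k

IsPartition : List ℕ → Set
IsPartition l = All (λ x → 1 ≤ x) l × Linked _≥_ l

mult : ℕ → List ℕ → ℕ
mult i l = length (filter (_≟ i) l)

InPf : (ℕ → ℕ∞) → List ℕ → Set
InPf f l = IsPartition l × (∀ i → 1 ≤ i → mult i l ≤∞ f i)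

zipPad : (ℕ → ℕ → ℕ) → List ℕ → List ℕ → List ℕ
zipPad g []       []       = []
zipPad g []       (y ∷ ys) = g 0 y ∷ zipPad g [] ys
zipPad g (x ∷ xs) []       = g x 0 ∷ zipPad g xs []
zipPad g (x ∷ xs) (y ∷ ys) = g x y ∷ zipPad g xs ys

dropZeros : List ℕ → List ℕ
dropZeros []            = []
dropZeros (zero  ∷ xs)  = dropZeros xs
dropZeros (suc x ∷ xs)  = suc x ∷ dropZeros xs

_∨ʸ_ : List ℕ → List ℕ → List ℕ
l ∨ʸ m = dropZeros (zipPad _⊔_ l m)

_∧ʸ_ : List ℕ → List ℕ → List ℕ
l ∧ʸ m = dropZeros (zipPad _⊓_ l m)

Pf : (ℕ → ℕ∞) → Set
Pf f = Σ (List ℕ) (InPf f)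

_≈Pf_ : {f : ℕ → ℕ∞} → Pf f → Pf f → Set
x ≈Pf y = proj₁ x ≡ proj₁ y

ClosedUnder : (ℕ → ℕ∞) → (List ℕ → List ℕ → List ℕ) → Set
ClosedUnder f op = ∀ l m → InPf f l → InPf f m → InPf f (op l m)

restrict : (f : ℕ → ℕ∞) (op : List ℕ → List ℕ → List ℕ) → ClosedUnder f op →
           Pf f → Pf f → Pf f
restrict f op c (l , p) (m , q) = op l m , c l m p q

-- A partition is determined by its sequence of parts, padded with zeros, and the Young join
-- and meet are the pointwise max and min of these sequences. So taking parts is an injective
-- lattice homomorphism into the pointwise distributive lattice ℕ → ℕ, and distributivity
-- pulls back along it.
-- For closure, the part i ≥ 1 occurs in λ ∨ μ or λ ∧ μ at most max(m_i(λ), m_i(μ)) times.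
-- Meet: at the first position j with λ_j ⊓ μ_j = i, say λ_j = i; from there on λ ≤ i, so
-- every later i of the meet is an i of λ. Join: at such a position, if μ_j < i then μ stays
-- below i and every later i of the join is an i of λ; if λ_j = μ_j = i, pass to the tails.
module Submission where

open import Defs
open import Data.Nat using (ℕ; zero; suc; _≤_; _<_; _≥_; _⊔_; _⊓_; _≟_; z≤n; s≤s)
open import Data.Nat.Properties
open import Data.List using (List; []; _∷_; length)
open import Data.List.Properties using (filter-accept; filter-reject)
open import Data.List.Relation.Unary.All using (All; []; _∷_)
open import Data.List.Relation.Unary.Linked using (Linked; []; [-]; _∷_; tail)
open import Data.Maybe using (just; nothing)
open import Data.Unit using (tt)
open import Data.Product using (Σ; _×_; _,_; proj₁; proj₂)
open import Data.Sum using (inj₁; inj₂)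
open import Function using (_∘_; flip)
open import Level using (Level)
open import Relation.Nullary using (yes; no; contradiction)
open import Relation.Binary.Core using (Rel; _Preserves₂_⟶_⟶_)
open import Relation.Binary.PropositionalEquality
open import Algebra.Core using (Op₂)
open import Algebra.Lattice.Bundles using (RawLattice)
open import Algebra.Lattice.Structures using (IsDistributiveLattice)
open import Algebra.Lattice.Morphism.Structures using (module LatticeMorphisms)
import Algebra.Lattice.Morphism.LatticeMonomorphism as LatticeMonomorphism
import Algebra.Construct.Pointwise as Pointwise

part : List ℕ → ℕ → ℕ
part []       _       = 0
part (x ∷ xs) zero    = x
part (x ∷ xs) (suc j) = part xs j

part-zipPad : (g : Op₂ ℕ) → g 0 0 ≡ 0 →
              ∀ xs ys j → part (zipPad g xs ys) j ≡ g (part xs j) (part ys j)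
part-zipPad g g-0 []       []       j       = sym g-0
part-zipPad g g-0 []       (y ∷ ys) zero    = refl
part-zipPad g g-0 []       (y ∷ ys) (suc j) = part-zipPad g g-0 [] ys j
part-zipPad g g-0 (x ∷ xs) []       zero    = refl
part-zipPad g g-0 (x ∷ xs) []       (suc j) = part-zipPad g g-0 xs [] j
part-zipPad g g-0 (x ∷ xs) (y ∷ ys) zero    = refl
part-zipPad g g-0 (x ∷ xs) (y ∷ ys) (suc j) = part-zipPad g g-0 xs ys j

zipPad-flip : (g : Op₂ ℕ) → ∀ xs ys → zipPad g xs ys ≡ zipPad (flip g) ys xs
zipPad-flip g []       []       = refl
zipPad-flip g []       (y ∷ ys) = cong (g 0 y ∷_) (zipPad-flip g [] ys)
zipPad-flip g (x ∷ xs) []       = cong (g x 0 ∷_) (zipPad-flip g xs [])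
zipPad-flip g (x ∷ xs) (y ∷ ys) = cong (g x y ∷_) (zipPad-flip g xs ys)

Linked⇒part-antitone : ∀ {l} → Linked _≥_ l → ∀ j → part l (suc j) ≤ part l j
Linked⇒part-antitone []        _       = z≤n
Linked⇒part-antitone [-]       _       = z≤n
Linked⇒part-antitone (x≥y ∷ _) zero    = x≥y
Linked⇒part-antitone (_ ∷ l↓)  (suc j) = Linked⇒part-antitone l↓ j

part-antitone⇒Linked : ∀ l → (∀ j → part l (suc j) ≤ part l j) → Linked _≥_ l
part-antitone⇒Linked []          _ = []
part-antitone⇒Linked (x ∷ [])    _ = [-]
part-antitone⇒Linked (x ∷ y ∷ l) h = h 0 ∷ part-antitone⇒Linked (y ∷ l) (h ∘ suc)

part-≤-head : ∀ {x xs} → Linked _≥_ (x ∷ xs) → ∀ j → part (x ∷ xs) j ≤ x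
part-≤-head x∷xs↓ zero    = ≤-refl
part-≤-head x∷xs↓ (suc j) = ≤-trans (Linked⇒part-antitone x∷xs↓ j) (part-≤-head x∷xs↓ j)

part-injective : ∀ {l m} → All (1 ≤_) l → All (1 ≤_) m →
                 (∀ j → part l j ≡ part m j) → l ≡ m
part-injective []        []        _ = refl
part-injective []        (y>0 ∷ _) h = contradiction (h 0) (<⇒≢ y>0)
part-injective (x>0 ∷ _) []        h = contradiction (sym (h 0)) (<⇒≢ x>0)
part-injective (_ ∷ l>0) (_ ∷ m>0) h = cong₂ _∷_ (h 0) (part-injective l>0 m>0 (h ∘ suc))

dropZeros-positive : ∀ xs → All (1 ≤_) (dropZeros xs)
dropZeros-positive []           = []
dropZeros-positive (zero  ∷ xs) = dropZeros-positive xs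
dropZeros-positive (suc x ∷ xs) = s≤s z≤n ∷ dropZeros-positive xs

-- In a decreasing list all zeros are trailing, so removing them does not shift any part.
part-dropZeros : ∀ {xs} → Linked _≥_ xs → ∀ j → part (dropZeros xs) j ≡ part xs j
part-dropZeros {[]}         _     j       = refl
part-dropZeros {zero  ∷ xs} 0∷xs↓ j       = begin
  part (dropZeros xs) j ≡⟨ part-dropZeros (tail 0∷xs↓) j ⟩
  part xs j             ≡⟨ n≤0⇒n≡0 (part-≤-head 0∷xs↓ (suc j)) ⟩
  0                     ≡⟨ n≤0⇒n≡0 (part-≤-head 0∷xs↓ j) ⟨
  part (0 ∷ xs) j       ∎
  where open ≡-Reasoning
part-dropZeros {suc x ∷ xs} _     zero    = refl
part-dropZeros {suc x ∷ xs} x∷xs↓ (suc j) = part-dropZeros (tail x∷xs↓) j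

dropZeros-decreasing : ∀ {xs} → Linked _≥_ xs → Linked _≥_ (dropZeros xs)
dropZeros-decreasing {xs} xs↓ = part-antitone⇒Linked (dropZeros xs) λ j →
  subst₂ _≤_ (sym (part-dropZeros xs↓ (suc j))) (sym (part-dropZeros xs↓ j))
         (Linked⇒part-antitone xs↓ j)

mult-∷-≡ : ∀ {i a} l → a ≡ i → mult i (a ∷ l) ≡ suc (mult i l)
mult-∷-≡ {i} l a≡i = cong length (filter-accept (_≟ i) {xs = l} a≡i)

mult-∷-≢ : ∀ {i a} l → a ≢ i → mult i (a ∷ l) ≡ mult i l
mult-∷-≢ {i} l a≢i = cong length (filter-reject (_≟ i) {xs = l} a≢i)

mult-≤-∷ : ∀ i a l → mult i l ≤ mult i (a ∷ l)
mult-≤-∷ i a l with a ≟ i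
... | yes a≡i = ≤-trans (n≤1+n _) (≤-reflexive (sym (mult-∷-≡ l a≡i)))
... | no  a≢i = ≤-reflexive (sym (mult-∷-≢ l a≢i))

mult-∷-≤ : ∀ {i a b} l m → (a ≡ i → b ≡ i) → mult i l ≤ mult i m →
           mult i (a ∷ l) ≤ mult i (b ∷ m)
mult-∷-≤ {i} {a} {b} l m a→b l≤m with a ≟ i
... | yes a≡i = begin
  mult i (a ∷ l)   ≡⟨ mult-∷-≡ l a≡i ⟩
  suc (mult i l)   ≤⟨ s≤s l≤m ⟩
  suc (mult i m)   ≡⟨ mult-∷-≡ m (a→b a≡i) ⟨
  mult i (b ∷ m)   ∎
  where open ≤-Reasoning
... | no  a≢i = begin
  mult i (a ∷ l)   ≡⟨ mult-∷-≢ l a≢i ⟩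
  mult i l         ≤⟨ l≤m ⟩
  mult i m         ≤⟨ mult-≤-∷ i b m ⟩
  mult i (b ∷ m)   ∎
  where open ≤-Reasoning

mult-dropZeros-≤ : ∀ i xs → mult i (dropZeros xs) ≤ mult i xs
mult-dropZeros-≤ i []           = z≤n
mult-dropZeros-≤ i (zero  ∷ xs) = ≤-trans (mult-dropZeros-≤ i xs) (mult-≤-∷ i 0 xs)
mult-dropZeros-≤ i (suc x ∷ xs) = mult-∷-≤ {a = suc x} (dropZeros xs) xs (λ e → e) (mult-dropZeros-≤ i xs)

mult-zipPad-≤ˡ : (g : Op₂ ℕ) → ∀ {i} → 1 ≤ i → ∀ xs ys →
                 (∀ j → g (part xs j) (part ys j) ≡ i → part xs j ≡ i) →
                 mult i (zipPad g xs ys) ≤ mult i xs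
mult-zipPad-≤ˡ g i≥1 []       []       h = z≤n
mult-zipPad-≤ˡ g i≥1 []       (y ∷ ys) h = ≤-trans
  (≤-reflexive (mult-∷-≢ (zipPad g [] ys) (<⇒≢ i≥1 ∘ h 0)))
  (mult-zipPad-≤ˡ g i≥1 [] ys (h ∘ suc))
mult-zipPad-≤ˡ g i≥1 (x ∷ xs) []       h =
  mult-∷-≤ (zipPad g xs []) xs (h 0) (mult-zipPad-≤ˡ g i≥1 xs [] (h ∘ suc))
mult-zipPad-≤ˡ g i≥1 (x ∷ xs) (y ∷ ys) h =
  mult-∷-≤ (zipPad g xs ys) xs (h 0) (mult-zipPad-≤ˡ g i≥1 xs ys (h ∘ suc))

mult-zipPad-≤ʳ : (g : Op₂ ℕ) → ∀ {i} → 1 ≤ i → ∀ xs ys →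
                 (∀ j → g (part xs j) (part ys j) ≡ i → part ys j ≡ i) →
                 mult i (zipPad g xs ys) ≤ mult i ys
mult-zipPad-≤ʳ g i≥1 xs ys h = subst (λ zs → mult _ zs ≤ mult _ ys)
  (sym (zipPad-flip g xs ys)) (mult-zipPad-≤ˡ (flip g) i≥1 ys xs h)

m⊔n≡o∧n<o⇒m≡o : ∀ {m n o} → m ⊔ n ≡ o → n < o → m ≡ o
m⊔n≡o∧n<o⇒m≡o {m} {n} m⊔n≡o n<o with ⊔-sel m n
... | inj₁ m⊔n≡m = trans (sym m⊔n≡m) m⊔n≡o
... | inj₂ m⊔n≡n = contradiction (trans (sym m⊔n≡n) m⊔n≡o) (<⇒≢ n<o)

m⊔n≡o∧m<o⇒n≡o : ∀ {m n o} → m ⊔ n ≡ o → m < o → n ≡ o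
m⊔n≡o∧m<o⇒n≡o {m} {n} m⊔n≡o = m⊔n≡o∧n<o⇒m≡o (trans (⊔-comm n m) m⊔n≡o)

m⊓n≡o∧m≤o⇒m≡o : ∀ {m n o} → m ⊓ n ≡ o → m ≤ o → m ≡ o
m⊓n≡o∧m≤o⇒m≡o {m} {n} m⊓n≡o m≤o = ≤-antisym m≤o (subst (_≤ m) m⊓n≡o (m⊓n≤m m n))

m⊓n≡o∧n≤o⇒n≡o : ∀ {m n o} → m ⊓ n ≡ o → n ≤ o → n ≡ o
m⊓n≡o∧n≤o⇒n≡o {m} {n} m⊓n≡o = m⊓n≡o∧m≤o⇒m≡o (trans (⊓-comm n m) m⊓n≡o)

mult-∷-≤-⊔ : ∀ {i a x y} r l m → a ≢ i → mult i r ≤ mult i l ⊔ mult i m →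
             mult i (a ∷ r) ≤ mult i (x ∷ l) ⊔ mult i (y ∷ m)
mult-∷-≤-⊔ {i} {a} {x} {y} r l m a≢i r≤l⊔m = begin
  mult i (a ∷ r)                  ≡⟨ mult-∷-≢ r a≢i ⟩
  mult i r                        ≤⟨ r≤l⊔m ⟩
  mult i l ⊔ mult i m             ≤⟨ ⊔-mono-≤ (mult-≤-∷ i x l) (mult-≤-∷ i y m) ⟩
  mult i (x ∷ l) ⊔ mult i (y ∷ m) ∎
  where open ≤-Reasoning

mult-zipPad-⊔ : ∀ {i} → 1 ≤ i → ∀ {xs ys} → Linked _≥_ xs → Linked _≥_ ys →
                mult i (zipPad _⊔_ xs ys) ≤ mult i xs ⊔ mult i ys
mult-zipPad-⊔ i≥1 {[]}     {ys} _ _ = mult-zipPad-≤ʳ _⊔_ i≥1 [] ys (λ _ e → e)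
mult-zipPad-⊔ i≥1 {x ∷ xs} {[]} _ _ = ≤-trans
  (mult-zipPad-≤ˡ _⊔_ i≥1 (x ∷ xs) [] (λ _ e → trans (sym (⊔-identityʳ _)) e))
  (m≤m⊔n _ _)
mult-zipPad-⊔ {i} i≥1 {x ∷ xs} {y ∷ ys} x∷xs↓ y∷ys↓ with x ⊔ y ≟ i
... | no x⊔y≢i = mult-∷-≤-⊔ {x = x} {y = y} (zipPad _⊔_ xs ys) xs ys x⊔y≢i
                   (mult-zipPad-⊔ i≥1 (tail x∷xs↓) (tail y∷ys↓))
... | yes x⊔y≡i with x ≟ i | y ≟ i
...   | yes x≡i | yes y≡i = begin
  mult i (x ⊔ y ∷ zipPad _⊔_ xs ys) ≡⟨ mult-∷-≡ _ x⊔y≡i ⟩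
  suc (mult i (zipPad _⊔_ xs ys))   ≤⟨ s≤s (mult-zipPad-⊔ i≥1 (tail x∷xs↓) (tail y∷ys↓)) ⟩
  suc (mult i xs ⊔ mult i ys)       ≡⟨ cong₂ _⊔_ (mult-∷-≡ xs x≡i) (mult-∷-≡ ys y≡i) ⟨
  mult i (x ∷ xs) ⊔ mult i (y ∷ ys) ∎
  where open ≤-Reasoning
...   | _       | no y≢i  = ≤-trans
  (mult-zipPad-≤ˡ _⊔_ i≥1 (x ∷ xs) (y ∷ ys) λ j e →
     m⊔n≡o∧n<o⇒m≡o e (≤-<-trans (part-≤-head y∷ys↓ j) y<i))
  (m≤m⊔n _ _)
  where y<i : y < i
        y<i = ≤∧≢⇒< (≤-trans (m≤n⊔m x y) (≤-reflexive x⊔y≡i)) y≢i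
...   | no x≢i  | yes _   = ≤-trans
  (mult-zipPad-≤ʳ _⊔_ i≥1 (x ∷ xs) (y ∷ ys) λ j e →
     m⊔n≡o∧m<o⇒n≡o e (≤-<-trans (part-≤-head x∷xs↓ j) x<i))
  (m≤n⊔m _ _)
  where x<i : x < i
        x<i = ≤∧≢⇒< (≤-trans (m≤m⊔n x y) (≤-reflexive x⊔y≡i)) x≢i

mult-zipPad-⊓ : ∀ {i} → 1 ≤ i → ∀ {xs ys} → Linked _≥_ xs → Linked _≥_ ys →
                mult i (zipPad _⊓_ xs ys) ≤ mult i xs ⊔ mult i ys
mult-zipPad-⊓ i≥1 {[]}     {ys} _ _ =
  ≤-trans (mult-zipPad-≤ˡ _⊓_ i≥1 [] ys (λ _ e → e)) z≤n
mult-zipPad-⊓ i≥1 {x ∷ xs} {[]} _ _ =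
  ≤-trans (mult-zipPad-≤ʳ _⊓_ i≥1 (x ∷ xs) [] (λ _ e → trans (sym (⊓-zeroʳ _)) e)) z≤n
mult-zipPad-⊓ {i} i≥1 {x ∷ xs} {y ∷ ys} x∷xs↓ y∷ys↓ with x ⊓ y ≟ i
... | no x⊓y≢i = mult-∷-≤-⊔ {x = x} {y = y} (zipPad _⊓_ xs ys) xs ys x⊓y≢i
                   (mult-zipPad-⊓ i≥1 (tail x∷xs↓) (tail y∷ys↓))
... | yes x⊓y≡i with ⊓-sel x y
...   | inj₁ x⊓y≡x = ≤-trans
  (mult-zipPad-≤ˡ _⊓_ i≥1 (x ∷ xs) (y ∷ ys) λ j e →
     m⊓n≡o∧m≤o⇒m≡o e (subst (part (x ∷ xs) j ≤_) x≡i (part-≤-head x∷xs↓ j)))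
  (m≤m⊔n _ _)
  where x≡i : x ≡ i
        x≡i = trans (sym x⊓y≡x) x⊓y≡i
...   | inj₂ x⊓y≡y = ≤-trans
  (mult-zipPad-≤ʳ _⊓_ i≥1 (x ∷ xs) (y ∷ ys) λ j e →
     m⊓n≡o∧n≤o⇒n≡o e (subst (part (y ∷ ys) j ≤_) y≡i (part-≤-head y∷ys↓ j)))
  (m≤n⊔m _ _)
  where y≡i : y ≡ i
        y≡i = trans (sym x⊓y≡y) x⊓y≡i

≤-≤∞-trans : ∀ {a b} (k : ℕ∞) → a ≤ b → b ≤∞ k → a ≤∞ k
≤-≤∞-trans nothing  _   _   = tt
≤-≤∞-trans (just k) a≤b b≤k = ≤-trans a≤b b≤k

⊔-≤∞ : ∀ {a b} (k : ℕ∞) → a ≤∞ k → b ≤∞ k → (a ⊔ b) ≤∞ k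
⊔-≤∞ nothing  _   _   = tt
⊔-≤∞ (just k) a≤k b≤k = ⊔-lub a≤k b≤k

module _ {g : Op₂ ℕ} (g-mono : g Preserves₂ _≤_ ⟶ _≤_ ⟶ _≤_) (g-0 : g 0 0 ≡ 0) where

  zipPad-decreasing : ∀ {xs ys} → Linked _≥_ xs → Linked _≥_ ys → Linked _≥_ (zipPad g xs ys)
  zipPad-decreasing {xs} {ys} xs↓ ys↓ = part-antitone⇒Linked (zipPad g xs ys) λ j →
    subst₂ _≤_ (sym (part-zipPad g g-0 xs ys (suc j))) (sym (part-zipPad g g-0 xs ys j))
           (g-mono (Linked⇒part-antitone xs↓ j) (Linked⇒part-antitone ys↓ j))

  part-dropZeros-zipPad : ∀ {xs ys} → Linked _≥_ xs → Linked _≥_ ys →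
                          ∀ j → part (dropZeros (zipPad g xs ys)) j ≡ g (part xs j) (part ys j)
  part-dropZeros-zipPad {xs} {ys} xs↓ ys↓ j =
    trans (part-dropZeros (zipPad-decreasing xs↓ ys↓) j) (part-zipPad g g-0 xs ys j)

  dropZeros-zipPad-closed :
    (∀ {i} → 1 ≤ i → ∀ {xs ys} → Linked _≥_ xs → Linked _≥_ ys →
       mult i (zipPad g xs ys) ≤ mult i xs ⊔ mult i ys) →
    ∀ f → ClosedUnder f (λ l m → dropZeros (zipPad g l m))
  dropZeros-zipPad-closed mult-zipPad f l m ((_ , l↓) , l∈Pf) ((_ , m↓) , m∈Pf) =
    (dropZeros-positive (zipPad g l m) , dropZeros-decreasing (zipPad-decreasing l↓ m↓)) ,
    λ i i≥1 → ≤-≤∞-trans (f i)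
      (≤-trans (mult-dropZeros-≤ i (zipPad g l m)) (mult-zipPad i≥1 l↓ m↓))
      (⊔-≤∞ (f i) (l∈Pf i i≥1) (m∈Pf i i≥1))

∨ʸ-closed : ∀ f → ClosedUnder f _∨ʸ_
∨ʸ-closed = dropZeros-zipPad-closed ⊔-mono-≤ refl mult-zipPad-⊔

∧ʸ-closed : ∀ f → ClosedUnder f _∧ʸ_
∧ʸ-closed = dropZeros-zipPad-closed ⊓-mono-≤ refl mult-zipPad-⊓

module _ {a c ℓ : Level} (A : Set a) {C : Set c} {_≈_ : Rel C ℓ} {_∨_ _∧_ : Op₂ C} where

  pointwise-isDistributiveLattice :
    IsDistributiveLattice _≈_ _∨_ _∧_ →
    IsDistributiveLattice (λ g h → ∀ x → g x ≈ h x)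
                          (λ g h x → g x ∨ h x) (λ g h x → g x ∧ h x)
  pointwise-isDistributiveLattice L = record
    { isLattice = record
      { isEquivalence = Pointwise.isEquivalence A L.isEquivalence
      ; ∨-comm        = λ g h x → L.∨-comm (g x) (h x)
      ; ∨-assoc       = λ g h k x → L.∨-assoc (g x) (h x) (k x)
      ; ∨-cong        = λ g≈g′ h≈h′ x → L.∨-cong (g≈g′ x) (h≈h′ x)
      ; ∧-comm        = λ g h x → L.∧-comm (g x) (h x)
      ; ∧-assoc       = λ g h k x → L.∧-assoc (g x) (h x) (k x)
      ; ∧-cong        = λ g≈g′ h≈h′ x → L.∧-cong (g≈g′ x) (h≈h′ x)
      ; absorptive    = (λ g h x → L.∨-absorbs-∧ (g x) (h x))
                      , (λ g h x → L.∧-absorbs-∨ (g x) (h x))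
      }
    ; ∨-distrib-∧ = (λ g h k x → L.∨-distribˡ-∧ (g x) (h x) (k x))
                  , (λ g h k x → L.∨-distribʳ-∧ (g x) (h x) (k x))
    ; ∧-distrib-∨ = (λ g h k x → L.∧-distribˡ-∨ (g x) (h x) (k x))
                  , (λ g h k x → L.∧-distribʳ-∨ (g x) (h x) (k x))
    }
    where module L = IsDistributiveLattice L

module _ (f : ℕ → ℕ∞) where

  Pf-rawLattice : RawLattice _ _
  Pf-rawLattice = record
    { Carrier = Pf f
    ; _≈_     = _≈Pf_
    ; _∨_     = restrict f _∨ʸ_ (∨ʸ-closed f)
    ; _∧_     = restrict f _∧ʸ_ (∧ʸ-closed f)
    }

  parts-rawLattice : RawLattice _ _
  parts-rawLattice = record
    { Carrier = ℕ → ℕ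
    ; _≈_     = λ g h → ∀ j → g j ≡ h j
    ; _∨_     = λ g h j → g j ⊔ h j
    ; _∧_     = λ g h j → g j ⊓ h j
    }

  parts : Pf f → ℕ → ℕ
  parts (l , _) = part l

  parts-isLatticeMonomorphism :
    LatticeMorphisms.IsLatticeMonomorphism Pf-rawLattice parts-rawLattice parts
  parts-isLatticeMonomorphism = record
    { isLatticeHomomorphism = record
      { isRelHomomorphism = record { cong = λ l≡m j → cong (λ l → part l j) l≡m }
      ; ∧-homo = λ (_ , (_ , l↓) , _) (_ , (_ , m↓) , _) →
                   part-dropZeros-zipPad ⊓-mono-≤ refl l↓ m↓
      ; ∨-homo = λ (_ , (_ , l↓) , _) (_ , (_ , m↓) , _) →
                   part-dropZeros-zipPad ⊔-mono-≤ refl l↓ m↓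
      }
    ; injective = λ { {_ , (l>0 , _) , _} {_ , (m>0 , _) , _} → part-injective l>0 m>0 }
    }

mainTheorem4 : (f : ℕ → ℕ∞) →
    Σ (ClosedUnder f _∨ʸ_ × ClosedUnder f _∧ʸ_) λ c →
      IsDistributiveLattice (_≈Pf_ {f}) (restrict f _∨ʸ_ (proj₁ c)) (restrict f _∧ʸ_ (proj₂ c))
mainTheorem4 f =
  (∨ʸ-closed f , ∧ʸ-closed f) ,
  LatticeMonomorphism.isDistributiveLattice (parts-isLatticeMonomorphism f)
    (pointwise-isDistributiveLattice ℕ ⊔-⊓-isDistributiveLattice)
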